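{- Let $G$ be a finite group, let $p$ be a prime, and let $H\trianglelefteq G$ be a normal subgroup with $G/H\cong C_p^2$. Then $$\mathsf d(G)\leq (\mathsf d(H)+2)p-2\leq \frac1p|G|+p-2.$$
   Context: A sequence over a finite group $G$ is a finite unordered list of elements of $G$ with repetition allowed; its length is its number of terms with multiplicity; a subsequence is a sub-multiset. It is product-one if its terms can be ordered so that their product is the identity. $\mathsf d(G)$ (the small Davenport constant) is the maximal integer $\ell$ such that there is a sequence over $G$ of length $\ell$ with no nonempty product-one subsequence. $C_p^2$ denotes the direct product of two cyclic groups of order $p$. -}

module Defs where

open import Level using (0ℓ)
open import Data.Nat using (ℕ; _+_; _≤_; NonZero)
open import Data.Nat.DivMod using (_mod_)
open import Data.Fin using (Fin; toℕ)
open import Data.List using (List; []; foldr; length)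
open import Data.List.Relation.Binary.Sublist.Propositional using (_⊆_)
open import Data.List.Relation.Binary.Permutation.Propositional using (_↭_)
open import Data.List.Relation.Unary.All using (All)
open import Data.Product using (Σ; _×_; ∃; _,_)
open import Relation.Nullary using (¬_)
open import Relation.Unary using (Pred; _∈_)
open import Relation.Binary.PropositionalEquality using (_≡_; _≢_)
open import Algebra.Structures using (IsGroup)
open import Data.Nat.Primality using (Prime; prime⇒nonZero)

record FinGroup (n : ℕ) : Set where
  field
    _·_ : Fin n → Fin n → Fin n
    e   : Fin n
    inv : Fin n → Fin n
    isGroup : IsGroup (_≡_ {A = Fin n}) _·_ e inv

module _ {n : ℕ} (G : FinGroup n) where
  open FinGroup G

  prod : List (Fin n) → Fin n
  prod = foldr _·_ e

  -- a sequence (unordered) is product-one if some ordering of it has product e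
  ProductOne : List (Fin n) → Set
  ProductOne S = Σ (List (Fin n)) λ U → (U ↭ S) × (prod U ≡ e)

  ProductOneFree : List (Fin n) → Set
  ProductOneFree S = ∀ T → T ⊆ S → T ≢ [] → ¬ ProductOne T

  record IsNormalSubgroup (H : Pred (Fin n) 0ℓ) : Set where
    field
      e∈H   : e ∈ H
      ·-closed : ∀ {x y} → x ∈ H → y ∈ H → (x · y) ∈ H
      inv-closed : ∀ {x} → x ∈ H → inv x ∈ H
      conj-closed : ∀ g {h} → h ∈ H → ((g · h) · inv g) ∈ H

  -- d is the small Davenport constant of the subgroup H
  -- (sequences over H = sequences over G all of whose terms lie in H).
  -- Taking H = everything gives d(G).
  IsSmallDavenportOf : Pred (Fin n) 0ℓ → ℕ → Set
  IsSmallDavenportOf H d =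
    (Σ (List (Fin n)) λ S → All H S × length S ≡ d × ProductOneFree S)
    × (∀ S → All H S → ProductOneFree S → length S ≤ d)

  IsSmallDavenport : ℕ → Set
  IsSmallDavenport = IsSmallDavenportOf (λ _ → Data.Unit.⊤)
    where import Data.Unit

-- the group C_p × C_p, realised on Fin p × Fin p with componentwise addition mod p
module _ {p : ℕ} (pr : Prime p) where
  private instance
    nz : NonZero p
    nz = prime⇒nonZero pr

  _+ₚ_ : Fin p → Fin p → Fin p
  a +ₚ b = (toℕ a + toℕ b) mod p

  -- G/H ≅ C_p^2: an isomorphism from the quotient G/H (cosets xH, with
  -- xH = yH iff x⁻¹y ∈ H) onto C_p × C_p, given by a map on representatives.
  QuotientIsoCp² : ∀ {n} (G : FinGroup n) → Pred (Fin n) 0ℓ → Set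
  QuotientIsoCp² {n} G H =
    Σ (Fin n → Fin p × Fin p) λ f →
      (∀ x y → (FinGroup._·_ G (FinGroup.inv G x) y ∈ H → f x ≡ f y)
             × (f x ≡ f y → FinGroup._·_ G (FinGroup.inv G x) y ∈ H))
      × (∀ x y → f (FinGroup._·_ G x y) ≡
                   ((Data.Product.proj₁ (f x) +ₚ Data.Product.proj₁ (f y)) ,
                    (Data.Product.proj₂ (f x) +ₚ Data.Product.proj₂ (f y))))
      × (∀ c → ∃ λ x → f x ≡ c)
    where import Data.Product

{-# OPTIONS --safe #-}

-- Read the quotient map G → G/H ≅ C_p² in coordinates: if the coordinate sums of a sequence
-- vanish mod p, then its product, in whatever order, lies in H. Olson's bound
-- D(C_pᵏ) ≤ k(p − 1) + 1 is proved by the polynomial method: with φ(x) = Σ_{n<p} (−1)ⁿ (x choose n),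
-- which is 1 at 0, divisible by p off pℕ and of degree p − 1, the function Φ(t) = Πᵢ φ(tᵢ) has
-- degree k(p − 1), so more than k(p − 1) difference operators kill it, while Φ(0) = 1.
-- Applied in C_p³ with an extra constant coordinate, Olson's bound gives η(C_p²) ≤ 3p − 2: every
-- 3p − 2 terms contain a nonempty zero-sum subsequence of length at most p. Hence a product-one
-- free S with |S| ≥ (d(H) + 2)p − 1 splits off d(H) + 1 disjoint zero-sum blocks, whose products
-- form a product-one free sequence over H that is too long. For the second inequality, the
-- d(H) + 1 prefix products of a product-one free sequence over H of length d(H) are distinct
-- elements of H, and their left translates by representatives of the p² cosets of H are distinct.
module Submission where

open import Level using (0ℓ)
open import Function using (_∘_)
open import Function.Bundles using (Injection)
open import Function.Properties.Inverse using (↔⇒↣)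
open import Data.Empty using (⊥-elim)
open import Data.Product using (∃; ∃-syntax; _×_; _,_; proj₁; proj₂)
open import Data.Sum using (_⊎_; inj₁; inj₂; [_,_])
open import Relation.Nullary using (¬_; yes; no)
open import Relation.Unary using (Pred; _∈_)
open import Relation.Binary.Definitions using (tri<; tri≈; tri>)
open import Relation.Binary.PropositionalEquality
  using (_≡_; _≢_; refl; sym; trans; cong; cong₂; subst; module ≡-Reasoning)
open import Algebra.Structures using (IsGroup)
open import Algebra.Bundles using (Group)
import Algebra.Properties.Group as GroupProperties

open import Data.Nat using (ℕ; zero; suc; pred; _≤_; _<_; s≤s; z≤n)
import Data.Nat as ℕ
import Data.Nat.Properties as ℕ
open import Data.Nat.DivMod using (_%_; _/_)
import Data.Nat.DivMod as ℕ
import Data.Nat.Divisibility as ℕ∣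
open import Data.Nat.Primality using (Prime; euclidsLemma; prime⇒nonZero; prime⇒nonTrivial)
open import Data.Nat.Combinatorics using (_C_; nC1≡n; nCk+nC[k+1]≡[n+1]C[k+1])
import Data.Nat.Tactic.RingSolver as ℕ-Solver
open import Data.Integer using (ℤ; +_; 0ℤ; 1ℤ; -1ℤ)
import Data.Integer as ℤ
import Data.Integer.Properties as ℤ
import Data.Integer.Divisibility.Signed as ℤ∣
open import Data.Integer.Tactic.RingSolver using (solve-∀)
open import Data.Fin using (Fin; zero; suc; toℕ; remQuot)
import Data.Fin.Properties as Fin

open import Data.List as List using (List; []; _∷_; _++_; concat; length; map; take; drop)
import Data.List.Properties as List
open import Data.Nat.ListAction using (sum)
open import Data.List.Relation.Unary.All as All using (All; []; _∷_)
import Data.List.Relation.Unary.All.Properties as All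
open import Data.List.Relation.Binary.Sublist.Propositional
  using (_⊆_; []; _∷_; _∷ʳ_; ⊆-trans; ⊆-reflexive; minimum)
import Data.List.Relation.Binary.Sublist.Heterogeneous as Sublist
open import Data.List.Relation.Binary.Sublist.Propositional.Properties
  using (concat⁺; take-⊆; drop-⊆; length-mono-≤; All-resp-⊆)
open import Data.List.Relation.Binary.Permutation.Propositional
  using (_↭_; prep; swap; ↭-refl; ↭-sym; ↭-trans)
import Data.List.Relation.Binary.Permutation.Propositional as ↭
open import Data.List.Relation.Binary.Permutation.Propositional.Properties
  using (++⁺ˡ; shift; shifts; ↭-map-inv; ↭-empty-inv; All-resp-↭)
open import Data.Vec using (Vec; []; _∷_; replicate; zipWith; _[_]%=_)
import Data.Vec as Vec
open import Data.Vec.Relation.Unary.All using ([]; _∷_) renaming (All to Allᵛ)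
open import Data.Vec.Relation.Binary.Pointwise.Inductive
  using (Pointwise-≡⇒≡; zipWith-assoc; zipWith-comm; zipWith-identityʳ)

open import Defs

-- Sub-multisets: the subsequences of the paper.
infix 4 _⊆ₘ_

_⊆ₘ_ : {A : Set} → List A → List A → Set
xs ⊆ₘ ys = ∃[ zs ] zs ⊆ ys × zs ↭ xs

module _ {A : Set} where
  open import Data.Nat using (_+_)

  ⊆⇒⊆ₘ : ∀ {xs ys : List A} → xs ⊆ ys → xs ⊆ₘ ys
  ⊆⇒⊆ₘ τ = _ , τ , ↭-refl

  ↭-⊆ₘ-trans : ∀ {xs ys zs : List A} → xs ↭ ys → ys ⊆ₘ zs → xs ⊆ₘ zs
  ↭-⊆ₘ-trans ρ (ws , τ , σ) = ws , τ , ↭-trans σ (↭-sym ρ)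

  ⊆-↭⇒⊆ₘ : ∀ {xs ys zs : List A} → xs ⊆ ys → ys ↭ zs → xs ⊆ₘ zs
  ⊆-↭⇒⊆ₘ τ ↭.refl = ⊆⇒⊆ₘ τ
  ⊆-↭⇒⊆ₘ (x ∷ʳ τ) (prep x ρ) with ws , τ′ , σ ← ⊆-↭⇒⊆ₘ τ ρ = ws , x ∷ʳ τ′ , σ
  ⊆-↭⇒⊆ₘ (refl ∷ τ) (prep x ρ) with ws , τ′ , σ ← ⊆-↭⇒⊆ₘ τ ρ = x ∷ ws , refl ∷ τ′ , prep x σ
  ⊆-↭⇒⊆ₘ (x ∷ʳ (y ∷ʳ τ)) (swap x y ρ) with ws , τ′ , σ ← ⊆-↭⇒⊆ₘ τ ρ =
    ws , y ∷ʳ x ∷ʳ τ′ , σ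
  ⊆-↭⇒⊆ₘ (x ∷ʳ (refl ∷ τ)) (swap x y ρ) with ws , τ′ , σ ← ⊆-↭⇒⊆ₘ τ ρ =
    y ∷ ws , refl ∷ x ∷ʳ τ′ , prep y σ
  ⊆-↭⇒⊆ₘ (refl ∷ (y ∷ʳ τ)) (swap x y ρ) with ws , τ′ , σ ← ⊆-↭⇒⊆ₘ τ ρ =
    x ∷ ws , y ∷ʳ refl ∷ τ′ , prep x σ
  ⊆-↭⇒⊆ₘ (refl ∷ (refl ∷ τ)) (swap x y ρ) with ws , τ′ , σ ← ⊆-↭⇒⊆ₘ τ ρ =
    y ∷ x ∷ ws , refl ∷ refl ∷ τ′ , swap y x σ
  ⊆-↭⇒⊆ₘ τ (↭.trans ρ₁ ρ₂) with _ , τ₁ , σ₁ ← ⊆-↭⇒⊆ₘ τ ρ₁ with ws , τ₂ , σ₂ ← ⊆-↭⇒⊆ₘ τ₁ ρ₂ =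
    ws , τ₂ , ↭-trans σ₂ σ₁

  ⊆ₘ-trans : ∀ {xs ys zs : List A} → xs ⊆ₘ ys → ys ⊆ₘ zs → xs ⊆ₘ zs
  ⊆ₘ-trans (_ , τ , σ) (_ , τ′ , σ′) with us , υ , π ← ⊆-↭⇒⊆ₘ τ (↭-sym σ′) =
    us , ⊆-trans υ τ′ , ↭-trans π σ

  length≡0⇒≡[] : ∀ {xs : List A} → length xs ≡ 0 → xs ≡ []
  length≡0⇒≡[] {[]} _ = refl

  complement : ∀ {xs ys : List A} → xs ⊆ ys → List A
  complement []       = []
  complement (y ∷ʳ τ) = y ∷ complement τ
  complement (_ ∷ τ)  = complement τ

  complement-⊆ : ∀ {xs ys : List A} (τ : xs ⊆ ys) → complement τ ⊆ ys
  complement-⊆ []               = []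
  complement-⊆ (y ∷ʳ τ)         = refl ∷ complement-⊆ τ
  complement-⊆ (_∷_ {y = y} _ τ) = y ∷ʳ complement-⊆ τ

  length-complement : ∀ {xs ys : List A} (τ : xs ⊆ ys) → length ys ≡ length xs + length (complement τ)
  length-complement []         = refl
  length-complement (y ∷ʳ τ)   = trans (cong suc (length-complement τ)) (sym (ℕ.+-suc _ _))
  length-complement (refl ∷ τ) = cong suc (length-complement τ)

  ++-complement-⊆ₘ : ∀ {xs ys zs : List A} (τ : xs ⊆ ys) → zs ⊆ₘ complement τ → xs ++ zs ⊆ₘ ys
  ++-complement-⊆ₘ [] ([] , [] , σ) = [] , [] , σ
  ++-complement-⊆ₘ (y ∷ʳ τ) (ws , y ∷ʳ υ , σ) with us , υ′ , σ′ ← ++-complement-⊆ₘ τ (ws , υ , σ) =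
    us , y ∷ʳ υ′ , σ′
  ++-complement-⊆ₘ {xs} (y ∷ʳ τ) (y ∷ ws , refl ∷ υ , σ)
    with us , υ′ , σ′ ← ++-complement-⊆ₘ τ (ws , υ , ↭-refl) =
    y ∷ us , refl ∷ υ′ , ↭-trans (prep y σ′) (↭-trans (↭-sym (shift y xs ws)) (++⁺ˡ xs σ))
  ++-complement-⊆ₘ (refl ∷ τ) υ with us , υ′ , σ′ ← ++-complement-⊆ₘ τ υ =
    _ ∷ us , refl ∷ υ′ , prep _ σ′

  ⊆-map⁻ : ∀ {B : Set} (f : A → B) {ys} xs → ys ⊆ map f xs → ∃[ zs ] zs ⊆ xs × ys ≡ map f zs
  ⊆-map⁻ f []       []       = [] , [] , refl
  ⊆-map⁻ f (x ∷ xs) (_ ∷ʳ τ) with zs , υ , refl ← ⊆-map⁻ f xs τ = zs , x ∷ʳ υ , refl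
  ⊆-map⁻ f (x ∷ xs) (refl ∷ τ) with zs , υ , refl ← ⊆-map⁻ f xs τ = x ∷ zs , refl ∷ υ , refl

  concat⁺-↭ : ∀ {xss yss : List (List A)} → xss ↭ yss → concat xss ↭ concat yss
  concat⁺-↭ ↭.refl           = ↭-refl
  concat⁺-↭ (prep xs ρ)      = ++⁺ˡ xs (concat⁺-↭ ρ)
  concat⁺-↭ (swap xs ys ρ)   = ↭-trans (shifts xs ys) (++⁺ˡ ys (++⁺ˡ xs (concat⁺-↭ ρ)))
  concat⁺-↭ (↭.trans ρ₁ ρ₂)  = ↭-trans (concat⁺-↭ ρ₁) (concat⁺-↭ ρ₂)

  concat⁺-⊆ₘ : ∀ {xss yss : List (List A)} → xss ⊆ₘ yss → concat xss ⊆ₘ concat yss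
  concat⁺-⊆ₘ (zss , τ , σ) = ↭-⊆ₘ-trans (concat⁺-↭ (↭-sym σ)) (⊆⇒⊆ₘ (concat⁺ (Sublist.map ⊆-reflexive τ)))

  concat-≢[] : ∀ {xss : List (List A)} → xss ≢ [] → All (_≢ []) xss → concat xss ≢ []
  concat-≢[] {[]}            []≢[] _             = ⊥-elim ([]≢[] refl)
  concat-≢[] {[] ∷ xss}      _     ([]≢[] ∷ _)   = ⊥-elim ([]≢[] refl)
  concat-≢[] {(x ∷ xs) ∷ xss} _    _             ()

  All-resp-⊆ₘ : ∀ {P : Pred A 0ℓ} {xs ys : List A} → All P ys → xs ⊆ₘ ys → All P xs
  All-resp-⊆ₘ Pys (zs , τ , σ) = All-resp-↭ σ (All-resp-⊆ τ Pys)

module _ where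
  open import Data.Nat using (_+_; _*_)

  [k+1]*[n+1]C[k+1]≡[n+1]*nCk : ∀ n k → suc k * (suc n C suc k) ≡ suc n * (n C k)
  [k+1]*[n+1]C[k+1]≡[n+1]*nCk zero    zero    = refl
  [k+1]*[n+1]C[k+1]≡[n+1]*nCk zero    (suc k) = ℕ.*-zeroʳ (suc (suc k))
  [k+1]*[n+1]C[k+1]≡[n+1]*nCk (suc n) zero    =
    trans (ℕ.*-identityˡ _) (trans (nC1≡n (suc (suc n))) (sym (ℕ.*-identityʳ _)))
  [k+1]*[n+1]C[k+1]≡[n+1]*nCk (suc n) (suc k) = begin
    suc (suc k) * (suc (suc n) C suc (suc k))
      ≡⟨ cong (suc (suc k) *_) (sym (nCk+nC[k+1]≡[n+1]C[k+1] (suc n) (suc k))) ⟩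
    suc (suc k) * (suc n C suc k + suc n C suc (suc k))
      ≡⟨ cong (λ a → suc (suc k) * (a + suc n C suc (suc k))) (sym (nCk+nC[k+1]≡[n+1]C[k+1] n k)) ⟩
    suc (suc k) * ((n C k + n C suc k) + suc n C suc (suc k))
      ≡⟨ regroup k (n C k) (n C suc k) (suc n C suc (suc k)) ⟩
    (n C k + n C suc k) + (suc k * (n C k + n C suc k) + suc (suc k) * (suc n C suc (suc k)))
      ≡⟨ cong₂ (λ a b → (n C k + n C suc k) + (a + b))
               (trans (cong (suc k *_) (nCk+nC[k+1]≡[n+1]C[k+1] n k)) ([k+1]*[n+1]C[k+1]≡[n+1]*nCk n k))
               ([k+1]*[n+1]C[k+1]≡[n+1]*nCk n (suc k)) ⟩
    (n C k + n C suc k) + (suc n * (n C k) + suc n * (n C suc k))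
      ≡⟨ ungroup n (n C k) (n C suc k) ⟩
    suc (suc n) * (n C k + n C suc k)
      ≡⟨ cong (suc (suc n) *_) (nCk+nC[k+1]≡[n+1]C[k+1] n k) ⟩
    suc (suc n) * (suc n C suc k) ∎
    where
    open ≡-Reasoning
    regroup : ∀ k a b c → suc (suc k) * ((a + b) + c) ≡ (a + b) + (suc k * (a + b) + suc (suc k) * c)
    regroup = ℕ-Solver.solve-∀
    ungroup : ∀ n a b → (a + b) + (suc n * a + suc n * b) ≡ suc (suc n) * (a + b)
    ungroup = ℕ-Solver.solve-∀

module _ where
  open import Data.Integer using (_+_; _*_; _-_; _^_)

  Δ₁ : (ℕ → ℤ) → ℕ → ℤ
  Δ₁ ψ x = ψ (suc x) - ψ x

  Δ₁^ : ℕ → (ℕ → ℤ) → ℕ → ℤ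
  Δ₁^ zero    ψ = ψ
  Δ₁^ (suc c) ψ = Δ₁ (Δ₁^ c ψ)

  Δ₁^-Δ₁ : ∀ c ψ x → Δ₁^ c (Δ₁ ψ) x ≡ Δ₁^ (suc c) ψ x
  Δ₁^-Δ₁ zero    ψ x = refl
  Δ₁^-Δ₁ (suc c) ψ x = cong₂ _-_ (Δ₁^-Δ₁ c ψ (suc x)) (Δ₁^-Δ₁ c ψ x)

  DegreeBelow₁ : ℕ → (ℕ → ℤ) → Set
  DegreeBelow₁ d ψ = ∀ c → d ≤ c → ∀ x → Δ₁^ c ψ x ≡ 0ℤ

  binomialSum : ℕ → (ℕ → ℤ) → ℕ → ℤ
  binomialSum zero    a x = 0ℤ
  binomialSum (suc N) a x = a N * + (x C N) + binomialSum N a x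

  binomialSum-zero : ∀ N a → binomialSum (suc N) a 0 ≡ a 0
  binomialSum-zero zero    a = trans (ℤ.+-identityʳ _) (ℤ.*-identityʳ (a 0))
  binomialSum-zero (suc N) a =
    trans (cong (λ z → z + binomialSum (suc N) a 0) (ℤ.*-zeroʳ (a (suc N))))
          (trans (ℤ.+-identityˡ _) (binomialSum-zero N a))

  Δ₁-binomialSum : ∀ N a x → Δ₁ (binomialSum N a) x ≡ binomialSum (pred N) (a ∘ suc) x
  Δ₁-binomialSum zero          a x = refl
  Δ₁-binomialSum (suc zero)    a x = cancel (a 0)
    where
    cancel : ∀ c → (c * + 1 + 0ℤ) - (c * + 1 + 0ℤ) ≡ 0ℤ
    cancel = solve-∀
  Δ₁-binomialSum (suc (suc N)) a x = begin
    (c * + (suc x C suc N) + S (suc x)) - (c * + (x C suc N) + S x)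
      ≡⟨ cong (λ z → (c * z + S (suc x)) - (c * + (x C suc N) + S x))
              (trans (cong +_ (sym (nCk+nC[k+1]≡[n+1]C[k+1] x N))) (ℤ.pos-+ (x C N) (x C suc N))) ⟩
    (c * (+ (x C N) + + (x C suc N)) + S (suc x)) - (c * + (x C suc N) + S x)
      ≡⟨ pascal-step c (+ (x C N)) (+ (x C suc N)) (S (suc x)) (S x) ⟩
    c * + (x C N) + Δ₁ S x
      ≡⟨ cong (λ z → c * + (x C N) + z) (Δ₁-binomialSum (suc N) a x) ⟩
    binomialSum (suc N) (a ∘ suc) x ∎
    where
    open ≡-Reasoning
    c = a (suc N)
    S = binomialSum (suc N) a
    pascal-step : ∀ c u v s₁ s₀ → (c * (u + v) + s₁) - (c * v + s₀) ≡ c * u + (s₁ - s₀)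
    pascal-step = solve-∀

  binomialSum-degreeBelow : ∀ N a → DegreeBelow₁ N (binomialSum N a)
  binomialSum-degreeBelow N a c N≤c = vanish c N a (binomialSum N a) (λ _ → refl) N≤c
    where
    vanish : ∀ c N a ψ → (∀ x → ψ x ≡ binomialSum N a x) → N ≤ c → ∀ x → Δ₁^ c ψ x ≡ 0ℤ
    vanish zero    zero a ψ ψ≗ z≤n x = ψ≗ x
    vanish (suc c) N    a ψ ψ≗ N≤ x =
      trans (sym (Δ₁^-Δ₁ c ψ x)) (vanish c (pred N) (a ∘ suc) (Δ₁ ψ) Δψ≗ (ℕ.pred-mono-≤ N≤) x)
      where
      Δψ≗ : ∀ y → Δ₁ ψ y ≡ binomialSum (pred N) (a ∘ suc) y
      Δψ≗ y = trans (cong₂ _-_ (ψ≗ (suc y)) (ψ≗ y)) (Δ₁-binomialSum N a y)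

  alternatingBinomialSum : ∀ k y → binomialSum (suc k) (-1ℤ ^_) (suc y) ≡ -1ℤ ^ k * + (y C k)
  alternatingBinomialSum zero    y = refl
  alternatingBinomialSum (suc k) y = begin
    -1ℤ * s * + (suc y C suc k) + binomialSum (suc k) (-1ℤ ^_) (suc y)
      ≡⟨ cong₂ (λ u v → -1ℤ * s * u + v)
               (trans (cong +_ (sym (nCk+nC[k+1]≡[n+1]C[k+1] y k))) (ℤ.pos-+ (y C k) (y C suc k)))
               (alternatingBinomialSum k y) ⟩
    -1ℤ * s * (+ (y C k) + + (y C suc k)) + s * + (y C k)
      ≡⟨ telescope s (+ (y C k)) (+ (y C suc k)) ⟩
    -1ℤ * s * + (y C suc k) ∎
    where
    open ≡-Reasoning
    s = -1ℤ ^ k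
    telescope : ∀ s u v → -1ℤ * s * (u + v) + s * u ≡ -1ℤ * s * v
    telescope = solve-∀

module _ where
  open import Data.Nat using (_+_)

  infixl 6 _+ᵛ_

  _+ᵛ_ : ∀ {k} → Vec ℕ k → Vec ℕ k → Vec ℕ k
  _+ᵛ_ = zipWith _+_

  vsum : ∀ {k} → List (Vec ℕ k) → Vec ℕ k
  vsum = List.foldr _+ᵛ_ (replicate _ 0)

  +ᵛ-assoc : ∀ {k} (u v w : Vec ℕ k) → (u +ᵛ v) +ᵛ w ≡ u +ᵛ (v +ᵛ w)
  +ᵛ-assoc u v w = Pointwise-≡⇒≡ (zipWith-assoc ℕ.+-assoc u v w)

  +ᵛ-comm : ∀ {k} (u v : Vec ℕ k) → u +ᵛ v ≡ v +ᵛ u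
  +ᵛ-comm u v = Pointwise-≡⇒≡ (zipWith-comm ℕ.+-comm u v)

  +ᵛ-identityʳ : ∀ {k} (v : Vec ℕ k) → v +ᵛ replicate k 0 ≡ v
  +ᵛ-identityʳ v = Pointwise-≡⇒≡ (zipWith-identityʳ ℕ.+-identityʳ v)

  bump : ∀ {k} → Fin k → Vec ℕ k → Vec ℕ k
  bump j t = t [ j ]%= suc

  +ᵛ-bump : ∀ {k} (v : Vec ℕ k) j t → v +ᵛ bump j t ≡ bump j (v +ᵛ t)
  +ᵛ-bump (c ∷ v) zero    (x ∷ t) = cong (_∷ v +ᵛ t) (ℕ.+-suc c x)
  +ᵛ-bump (c ∷ v) (suc j) (x ∷ t) = cong (c + x ∷_) (+ᵛ-bump v j t)

  bumps : ∀ {k} → List (Fin k) → Vec ℕ k → Vec ℕ k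
  bumps w t = List.foldr bump t w

  sum-bump : ∀ {k} (j : Fin k) t → Vec.sum (bump j t) ≡ suc (Vec.sum t)
  sum-bump zero    (x ∷ t) = refl
  sum-bump (suc j) (x ∷ t) = trans (cong (x ℕ.+_) (sum-bump j t)) (ℕ.+-suc x (Vec.sum t))

  vsum-complement : ∀ {A : Set} {k} (χ : A → Vec ℕ k) {xs ys} (τ : xs ⊆ ys) →
                    vsum (map χ ys) ≡ vsum (map χ xs) +ᵛ vsum (map χ (complement τ))
  vsum-complement χ []         = sym (+ᵛ-identityʳ _)
  vsum-complement χ {xs} (_∷ʳ_ {ys = ys} y τ) = begin
    χ y +ᵛ vsum (map χ ys)         ≡⟨ cong (χ y +ᵛ_) (vsum-complement χ τ) ⟩
    χ y +ᵛ (Σxs +ᵛ Σc)             ≡⟨ +ᵛ-assoc (χ y) Σxs Σc ⟨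
    (χ y +ᵛ Σxs) +ᵛ Σc             ≡⟨ cong (_+ᵛ Σc) (+ᵛ-comm (χ y) Σxs) ⟩
    (Σxs +ᵛ χ y) +ᵛ Σc             ≡⟨ +ᵛ-assoc Σxs (χ y) Σc ⟩
    Σxs +ᵛ (χ y +ᵛ Σc)             ∎
    where
    open ≡-Reasoning
    Σxs = vsum (map χ xs)
    Σc  = vsum (map χ (complement τ))
  vsum-complement χ (refl ∷ τ) =
    trans (cong (χ _ +ᵛ_) (vsum-complement χ τ)) (sym (+ᵛ-assoc (χ _) _ _))

  vsum-count : ∀ {A : Set} {k} (χ : A → Vec ℕ k) xs →
               vsum (map (λ x → 1 ∷ χ x) xs) ≡ length xs ∷ vsum (map χ xs)
  vsum-count χ []       = refl
  vsum-count χ (x ∷ xs) = cong ((1 ∷ χ x) +ᵛ_) (vsum-count χ xs)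

  sum-replicate-0 : ∀ k → Vec.sum (replicate k 0) ≡ 0
  sum-replicate-0 zero    = refl
  sum-replicate-0 (suc k) = sum-replicate-0 k

  sum-bumps : ∀ {k} (w : List (Fin k)) t → Vec.sum (bumps w t) ≡ length w + Vec.sum t
  sum-bumps []      t = refl
  sum-bumps (j ∷ w) t = trans (sum-bump j (bumps w t)) (cong suc (sum-bumps w t))

module _ where
  open import Data.Integer using (_+_; _*_; _-_)

  Fun : ℕ → Set
  Fun k = Vec ℕ k → ℤ

  ∂ : ∀ {k} → Fin k → Fun k → Fun k
  ∂ j g t = g (bump j t) - g t

  ∂* : ∀ {k} → List (Fin k) → Fun k → Fun k
  ∂* []      g = g
  ∂* (j ∷ w) g = ∂ j (∂* w g)

  Δ : ∀ {k} → Vec ℕ k → Fun k → Fun k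
  Δ v g t = g (v +ᵛ t) - g t

  DegreeBelow : ∀ {k} → ℕ → Fun k → Set
  DegreeBelow d g = ∀ w → d ≤ length w → ∀ t → ∂* w g t ≡ 0ℤ

  DegreeBelow-mono : ∀ {k d e} {g : Fun k} → d ≤ e → DegreeBelow d g → DegreeBelow e g
  DegreeBelow-mono d≤e deg w e≤ = deg w (ℕ.≤-trans d≤e e≤)

  ∂-vanishing⇒translation-invariant : ∀ {k} (g : Fun k) → (∀ j t → ∂ j g t ≡ 0ℤ) →
                                      ∀ v t → g (v +ᵛ t) ≡ g t
  ∂-vanishing⇒translation-invariant g ∂g≡0 []      []      = refl
  ∂-vanishing⇒translation-invariant g ∂g≡0 (c ∷ v) (x ∷ t) =
    trans (shiftHead c)
          (∂-vanishing⇒translation-invariant (g ∘ (x ∷_)) (λ j → ∂g≡0 (suc j) ∘ (x ∷_)) v t)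
    where
    shiftHead : ∀ c → g (c ℕ.+ x ∷ v +ᵛ t) ≡ g (x ∷ v +ᵛ t)
    shiftHead zero    = refl
    shiftHead (suc c) = trans (ℤ.i-j≡0⇒i≡j _ _ (∂g≡0 zero (c ℕ.+ x ∷ v +ᵛ t))) (shiftHead c)

  ∂*-Δ : ∀ {k} w (v : Vec ℕ k) g t → ∂* w (Δ v g) t ≡ Δ v (∂* w g) t
  ∂*-Δ []      v g t = refl
  ∂*-Δ (j ∷ w) v g t = begin
    ∂* w (Δ v g) (bump j t) - ∂* w (Δ v g) t
      ≡⟨ cong₂ _-_ (∂*-Δ w v g (bump j t)) (∂*-Δ w v g t) ⟩
    (h (v +ᵛ bump j t) - h (bump j t)) - (h (v +ᵛ t) - h t)
      ≡⟨ cong (λ s → (h s - h (bump j t)) - (h (v +ᵛ t) - h t)) (+ᵛ-bump v j t) ⟩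
    (h (bump j (v +ᵛ t)) - h (bump j t)) - (h (v +ᵛ t) - h t)
      ≡⟨ interchange (h (bump j (v +ᵛ t))) (h (bump j t)) (h (v +ᵛ t)) (h t) ⟩
    (h (bump j (v +ᵛ t)) - h (v +ᵛ t)) - (h (bump j t) - h t) ∎
    where
    open ≡-Reasoning
    h = ∂* w g
    interchange : ∀ a b c d → (a - b) - (c - d) ≡ (a - c) - (b - d)
    interchange = solve-∀

  Δ-lowers-degree : ∀ {k d} (g : Fun k) v → DegreeBelow (suc d) g → DegreeBelow d (Δ v g)
  Δ-lowers-degree g v deg w d≤ t = trans (∂*-Δ w v g t) (ℤ.i≡j⇒i-j≡0
    (∂-vanishing⇒translation-invariant (∂* w g) (λ j → deg (j ∷ w) (s≤s d≤)) v t))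

  Δs : ∀ {k} → List (Vec ℕ k) → Fun k → Fun k
  Δs []      g = g
  Δs (v ∷ L) g = Δs L (Δ v g)

  Δs-vanishes : ∀ {k} L (g : Fun k) → DegreeBelow (length L) g → ∀ t → Δs L g t ≡ 0ℤ
  Δs-vanishes []      g deg t = deg [] z≤n t
  Δs-vanishes (v ∷ L) g deg   = Δs-vanishes L (Δ v g) (Δ-lowers-degree g v deg)

  ⨂ : ∀ {k} → (ℕ → ℤ) → Vec ℕ k → Fun k
  ⨂ ψ []       []      = 1ℤ
  ⨂ ψ (c ∷ cs) (x ∷ t) = Δ₁^ c ψ x * ⨂ ψ cs t

  ∂-⨂ : ∀ {k} ψ (j : Fin k) cs t → ∂ j (⨂ ψ cs) t ≡ ⨂ ψ (bump j cs) t
  ∂-⨂ ψ zero    (c ∷ cs) (x ∷ t) = distribʳ (Δ₁^ c ψ (suc x)) (Δ₁^ c ψ x) (⨂ ψ cs t)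
    where
    distribʳ : ∀ a b q → a * q - b * q ≡ (a - b) * q
    distribʳ = solve-∀
  ∂-⨂ ψ (suc j) (c ∷ cs) (x ∷ t) =
    trans (distribˡ (Δ₁^ c ψ x) (⨂ ψ cs (bump j t)) (⨂ ψ cs t)) (cong (Δ₁^ c ψ x *_) (∂-⨂ ψ j cs t))
    where
    distribˡ : ∀ a q r → a * q - a * r ≡ a * (q - r)
    distribˡ = solve-∀

  ∂*-⨂ : ∀ {k} ψ (w : List (Fin k)) cs t → ∂* w (⨂ ψ cs) t ≡ ⨂ ψ (bumps w cs) t
  ∂*-⨂ ψ []      cs t = refl
  ∂*-⨂ ψ (j ∷ w) cs t =
    trans (cong₂ _-_ (∂*-⨂ ψ w cs (bump j t)) (∂*-⨂ ψ w cs t)) (∂-⨂ ψ j (bumps w cs) t)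

  ⨂-vanishes : ∀ {k m} ψ → DegreeBelow₁ (suc m) ψ →
               (cs t : Vec ℕ k) → k ℕ.* m < Vec.sum cs → ⨂ ψ cs t ≡ 0ℤ
  ⨂-vanishes {m = m} ψ deg (c ∷ cs) (x ∷ t) km<Σ with m ℕ.<? c
  ... | yes m<c = cong (_* ⨂ ψ cs t) (deg c m<c x)
  ... | no  m≮c = trans (cong (Δ₁^ c ψ x *_) (⨂-vanishes ψ deg cs t (ℕ.+-cancelˡ-< m _ _ km<Σ′)))
                        (ℤ.*-zeroʳ (Δ₁^ c ψ x))
    where
    km<Σ′ = ℕ.<-≤-trans km<Σ (ℕ.+-monoˡ-≤ (Vec.sum cs) (ℕ.≮⇒≥ m≮c))

  ⨂-degreeBelow : ∀ {k m} ψ → DegreeBelow₁ (suc m) ψ → DegreeBelow (suc (k ℕ.* m)) (⨂ ψ (replicate k 0))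
  ⨂-degreeBelow {k} ψ deg w km<w t = trans (∂*-⨂ ψ w (replicate k 0) t)
    (⨂-vanishes ψ deg (bumps w (replicate k 0)) t (ℕ.<-≤-trans km<w (ℕ.≤-reflexive (sym Σbumps≡w))))
    where
    Σbumps≡w : Vec.sum (bumps w (replicate k 0)) ≡ length w
    Σbumps≡w = trans (sum-bumps w _) (trans (cong (length w ℕ.+_) (sum-replicate-0 k)) (ℕ.+-identityʳ _))

module _ (p : ℕ) where
  open import Data.Integer using (_+_; _-_)
  open ℤ∣ using (_∣_; _∣?_; ∣m∣n⇒∣m+n; ∣m∣n⇒∣m-n)

  infix 4 _≡±_

  _≡±_ : ℤ → ℤ → Set
  x ≡± y = (+ p ∣ x - y) ⊎ (+ p ∣ x + y)

  ≡±-flip : ∀ x a b → x ≡± a - b → + p ∣ a → x ≡± b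
  ≡±-flip x a b (inj₁ p∣x-[a-b]) p∣a = inj₂ (subst (+ p ∣_) (regroup₊ x a b) (∣m∣n⇒∣m+n p∣x-[a-b] p∣a))
    where
    regroup₊ : ∀ x a b → (x - (a - b)) + a ≡ x + b
    regroup₊ = solve-∀
  ≡±-flip x a b (inj₂ p∣x+[a-b]) p∣a = inj₁ (subst (+ p ∣_) (regroup₋ x a b) (∣m∣n⇒∣m-n p∣x+[a-b] p∣a))
    where
    regroup₋ : ∀ x a b → (x + (a - b)) - a ≡ x - b
    regroup₋ = solve-∀

  -- Δs L g t = Σ_{I ⊆ L} ± g(ΣI + t). Peeling off one vector at a time, either some nonempty I has
  -- g(ΣI + t) ≢ 0 mod p, or every term but ±g(t) vanishes mod p.
  Δs-dichotomy : ∀ {k} L (g : Fun k) t →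
    (∃[ I ] I ⊆ L × I ≢ [] × ¬ (+ p ∣ g (vsum I +ᵛ t))) ⊎ (Δs L g t ≡± g t)
  Δs-dichotomy [] g t = inj₂ (inj₁ (subst (+ p ∣_) (sym (ℤ.+-inverseʳ (g t))) (ℤ∣.∣ᵤ⇒∣ (p ℕ∣.∣0))))
  Δs-dichotomy (v ∷ L) g t with Δs-dichotomy L (Δ v g) t
  ... | inj₁ (I , I⊆L , I≢[] , p∤ΔgI) with + p ∣? g (vsum I +ᵛ t)
  ...   | no  p∤gI = inj₁ (I , v ∷ʳ I⊆L , I≢[] , p∤gI)
  ...   | yes p∣gI = inj₁ (v ∷ I , refl ∷ I⊆L , (λ ()) , λ p∣gvI →
          p∤ΔgI (∣m∣n⇒∣m-n (subst (+ p ∣_) (cong g (+ᵛ-assoc v (vsum I) t)) p∣gvI) p∣gI))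
  Δs-dichotomy (v ∷ L) g t | inj₂ Δs≡±Δg with + p ∣? g (v +ᵛ t)
  ... | yes p∣gv = inj₂ (≡±-flip (Δs L (Δ v g) t) (g (v +ᵛ t)) (g t) Δs≡±Δg p∣gv)
  ... | no  p∤gv = inj₁ (v ∷ [] , refl ∷ minimum L , (λ ()) ,
          p∤gv ∘ subst (+ p ∣_) (cong (λ u → g (u +ᵛ t)) (+ᵛ-identityʳ v)))

module ZeroSums {m : ℕ} (prime : Prime (suc m)) where
  open import Data.Integer using (_*_; _^_)
  open ℤ∣ using (∣m⇒∣m*n; ∣n⇒∣m*n)

  p : ℕ
  p = suc m

  φ : ℕ → ℤ
  φ = binomialSum p (-1ℤ ^_)

  φ-zero : φ 0 ≡ 1ℤ
  φ-zero = binomialSum-zero m (-1ℤ ^_)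

  p∣nCm : ∀ n → ¬ p ℕ∣.∣ suc n → p ℕ∣.∣ n C m
  p∣nCm n p∤n+1 with euclidsLemma (suc n) (n C m) prime
    (ℕ∣.divides (suc n C p) (trans (sym ([k+1]*[n+1]C[k+1]≡[n+1]*nCk n m)) (ℕ.*-comm p _)))
  ... | inj₁ p∣n+1 = ⊥-elim (p∤n+1 p∣n+1)
  ... | inj₂ p∣nCm = p∣nCm

  p∣φ : ∀ x → ¬ p ℕ∣.∣ x → + p ℤ∣.∣ φ x
  p∣φ zero    p∤0 = ⊥-elim (p∤0 (p ℕ∣.∣0))
  p∣φ (suc n) p∤x = subst (+ p ℤ∣.∣_) (sym (alternatingBinomialSum m n))
                          (∣n⇒∣m*n (-1ℤ ^ m) (ℤ∣.∣ᵤ⇒∣ (p∣nCm n p∤x)))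

  Φ : ∀ {k} → Fun k
  Φ {k} = ⨂ φ (replicate k 0)

  Φ-zero : ∀ k → Φ (replicate k 0) ≡ 1ℤ
  Φ-zero zero    = refl
  Φ-zero (suc k) = cong₂ _*_ φ-zero (Φ-zero k)

  p∤Φ⇒p∣coordinates : ∀ {k} (t : Vec ℕ k) → ¬ (+ p ℤ∣.∣ Φ t) → Allᵛ (p ℕ∣.∣_) t
  p∤Φ⇒p∣coordinates []      _   = []
  p∤Φ⇒p∣coordinates (x ∷ t) p∤Φ with p ℕ∣.∣? x
  ... | yes p∣x = p∣x ∷ p∤Φ⇒p∣coordinates t (p∤Φ ∘ ∣n⇒∣m*n (φ x))
  ... | no  p∤x = ⊥-elim (p∤Φ (∣m⇒∣m*n (Φ t) (p∣φ x p∤x)))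

  -- The coordinates χ x ∈ ℕᵏ stand for an element of C_pᵏ.
  ZeroSum : ∀ {A : Set} {k} → (A → Vec ℕ k) → List A → Set
  ZeroSum χ xs = Allᵛ (p ℕ∣.∣_) (vsum (map χ xs))

  ZeroSum-complement : ∀ {A : Set} {k} (χ : A → Vec ℕ k) {xs ys} (τ : xs ⊆ ys) →
                       ZeroSum χ ys → ZeroSum χ xs → ZeroSum χ (complement τ)
  ZeroSum-complement χ τ p∣ys p∣xs =
    ∣-cancelˡ _ _ (subst (Allᵛ (p ℕ∣.∣_)) (vsum-complement χ τ) p∣ys) p∣xs
    where
    ∣-cancelˡ : ∀ {k} (u v : Vec ℕ k) → Allᵛ (p ℕ∣.∣_) (u +ᵛ v) → Allᵛ (p ℕ∣.∣_) u → Allᵛ (p ℕ∣.∣_) v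
    ∣-cancelˡ []      []      []             []         = []
    ∣-cancelˡ (a ∷ u) (b ∷ v) (p∣a+b ∷ p∣u+v) (p∣a ∷ p∣u) = ℕ∣.∣m+n∣m⇒∣n p∣a+b p∣a ∷ ∣-cancelˡ u v p∣u+v p∣u

  p∤1 : ¬ (+ p ℤ∣.∣ 1ℤ)
  p∤1 p∣1 = ℕ.nonTrivial⇒≢1 {{prime⇒nonTrivial prime}} (ℕ∣.∣1⇒≡1 (ℤ∣.∣⇒∣ᵤ p∣1))

  olson : ∀ {A : Set} {k} (χ : A → Vec ℕ k) (T : List A) → k ℕ.* m < length T →
          ∃[ U ] U ⊆ T × U ≢ [] × ZeroSum χ U
  olson {k = k} χ T km<T with Δs-dichotomy p (map χ T) Φ (replicate k 0)
  ... | inj₁ (I , I⊆ , I≢[] , p∤ΦI) with U , U⊆T , refl ← ⊆-map⁻ χ T I⊆ =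
    U , U⊆T , I≢[] ∘ cong (map χ) ,
    p∤Φ⇒p∣coordinates _ (p∤ΦI ∘ subst (λ t → + p ℤ∣.∣ Φ {k} t) (sym (+ᵛ-identityʳ _)))
  ... | inj₂ Δs≡±Φ =
    ⊥-elim (p∤1 ([ ℤ∣.∣m⇒∣-m ∘ subst (+ p ℤ∣.∣_) 0-1≡-1 , subst (+ p ℤ∣.∣_) 0+1≡1 ] Δs≡±Φ))
    where
    Δs≡0 : Δs (map χ T) Φ (replicate k 0) ≡ 0ℤ
    Δs≡0 = Δs-vanishes (map χ T) Φ
      (DegreeBelow-mono (subst (ℕ._≤_ _) (sym (List.length-map χ T)) km<T)
                        (⨂-degreeBelow φ (binomialSum-degreeBelow p (-1ℤ ^_))))
      (replicate k 0)
    0-1≡-1 = cong₂ ℤ._-_ Δs≡0 (Φ-zero k)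
    0+1≡1  = cong₂ ℤ._+_ Δs≡0 (Φ-zero k)

  private
    2p≡2+2m : 2 ℕ.* p ≡ suc (suc (2 ℕ.* m))
    2p≡2+2m = identity m
      where
      identity : ∀ m → 2 ℕ.* suc m ≡ suc (suc (2 ℕ.* m))
      identity = ℕ-Solver.solve-∀
    3p≡3+3m : 3 ℕ.* p ≡ suc (suc (suc (3 ℕ.* m)))
    3p≡3+3m = identity m
      where
      identity : ∀ m → 3 ℕ.* suc m ≡ suc (suc (suc (3 ℕ.* m)))
      identity = ℕ-Solver.solve-∀

  ShortZeroSumIn : ∀ {A : Set} → (A → Vec ℕ 2) → List A → Set
  ShortZeroSumIn χ xs = ∃[ ys ] ys ⊆ xs × ys ≢ [] × ZeroSum χ ys × length ys ≤ p

  length≡2p⇒shortZeroSum : ∀ {A : Set} (χ : A → Vec ℕ 2) xs → ZeroSum χ xs → length xs ≡ 2 ℕ.* p →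
                           ShortZeroSumIn χ xs
  length≡2p⇒shortZeroSum χ (x ∷ xs) Zxs |x∷xs|≡2p with olson χ xs (ℕ.≤-reflexive (sym |xs|≡1+2m))
    where
    |xs|≡1+2m : length xs ≡ suc (2 ℕ.* m)
    |xs|≡1+2m = ℕ.suc-injective (trans |x∷xs|≡2p 2p≡2+2m)
  ... | ys , ys⊆xs , ys≢[] , Zys with length ys ℕ.≤? p
  ...   | yes |ys|≤p = ys , x ∷ʳ ys⊆xs , ys≢[] , Zys , |ys|≤p
  ...   | no  |ys|≰p = complement τ , complement-⊆ τ , zs≢[] , ZeroSum-complement χ τ Zxs Zys , |zs|≤p
    where
    τ = x ∷ʳ ys⊆xs
    |ys|+|zs|≡2p : length ys ℕ.+ length (complement τ) ≡ p ℕ.+ p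
    |ys|+|zs|≡2p = trans (sym (length-complement τ)) (trans |x∷xs|≡2p (cong (p ℕ.+_) (ℕ.+-identityʳ p)))
    zs≢[] : complement τ ≢ []
    zs≢[] zs≡[] = ℕ.<⇒≱ (s≤s (length-mono-≤ ys⊆xs)) (ℕ.≤-reflexive (trans (length-complement τ)
      (trans (cong (λ zs → length ys ℕ.+ length zs) zs≡[]) (ℕ.+-identityʳ _))))
    |zs|≤p : length (complement τ) ≤ p
    |zs|≤p = ℕ.≮⇒≥ λ p<|zs| → ℕ.<-irrefl (sym |ys|+|zs|≡2p) (ℕ.+-mono-< (ℕ.≰⇒> |ys|≰p) p<|zs|)

  shortZeroSum : ∀ {A : Set} (χ : A → Vec ℕ 2) xs → 3 ℕ.* m < length xs → ShortZeroSumIn χ xs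
  shortZeroSum χ xs 3m<|xs| = fromPrefix (olson (λ x → 1 ∷ χ x) pre (ℕ.≤-reflexive (sym |pre|≡1+3m)))
    where
    pre = take (suc (3 ℕ.* m)) xs
    |pre|≡1+3m : length pre ≡ suc (3 ℕ.* m)
    |pre|≡1+3m = trans (List.length-take _ xs) (ℕ.m≤n⇒m⊓n≡m 3m<|xs|)

    fromPrefix : ∃[ ys ] ys ⊆ pre × ys ≢ [] × ZeroSum (λ x → 1 ∷ χ x) ys → ShortZeroSumIn χ xs
    fromPrefix (ys , ys⊆pre , ys≢[] , Z₁ys)
      with ℕ∣.divides q |ys|≡qp ∷ Zys ← subst (Allᵛ (p ℕ∣.∣_)) (vsum-count χ ys) Z₁ys =
      byMultiplicity q |ys|≡qp
      where
      ys⊆xs = ⊆-trans ys⊆pre (take-⊆ _ xs)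
      byMultiplicity : ∀ q → length ys ≡ q ℕ.* p → ShortZeroSumIn χ xs
      byMultiplicity 0 |ys|≡0 = ⊥-elim (ys≢[] (length≡0⇒≡[] |ys|≡0))
      byMultiplicity 1 |ys|≡p = ys , ys⊆xs , ys≢[] , Zys , ℕ.≤-reflexive (trans |ys|≡p (ℕ.+-identityʳ p))
      byMultiplicity 2 |ys|≡2p with zs , zs⊆ys , short ← length≡2p⇒shortZeroSum χ ys Zys |ys|≡2p =
        zs , ⊆-trans zs⊆ys ys⊆xs , short
      byMultiplicity (suc (suc (suc q))) |ys|≡qp = ⊥-elim (ℕ.<⇒≱ |ys|<3p 3p≤|ys|)
        where
        |ys|<3p : length ys < 3 ℕ.* p
        |ys|<3p = ℕ.<-≤-trans (s≤s (subst (length ys ≤_) |pre|≡1+3m (length-mono-≤ ys⊆pre)))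
                              (ℕ.≤-trans (ℕ.n≤1+n _) (ℕ.≤-reflexive (sym 3p≡3+3m)))
        3p≤|ys| : 3 ℕ.* p ≤ length ys
        3p≤|ys| = subst (3 ℕ.* p ≤_) (sym |ys|≡qp)
                        (ℕ.*-monoˡ-≤ p {3} {suc (suc (suc q))} (s≤s (s≤s (s≤s z≤n))))

  ZeroSumBlocks : ∀ {A : Set} → (A → Vec ℕ 2) → ℕ → List A → Set
  ZeroSumBlocks χ r xs =
    ∃[ yss ] length yss ≡ suc r × All (λ ys → ys ≢ [] × ZeroSum χ ys) yss × concat yss ⊆ₘ xs

  zeroSumBlocks : ∀ {A : Set} (χ : A → Vec ℕ 2) r xs → (r ℕ.+ 2) ℕ.* p ≤ suc (length xs) →
                  ZeroSumBlocks χ r xs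
  zeroSumBlocks χ zero xs 2p≤1+|xs|
    with ys , ys⊆xs , ys≢[] , Zys ← olson χ xs (ℕ.≤-pred (subst (_≤ suc (length xs)) 2p≡2+2m 2p≤1+|xs|)) =
    ys ∷ [] , refl , (ys≢[] , Zys) ∷ [] , ⊆⇒⊆ₘ (subst (_⊆ xs) (sym (List.++-identityʳ ys)) ys⊆xs)
  zeroSumBlocks χ (suc r) xs bound = peel (shortZeroSum χ xs 3m<|xs|)
    where
    3m<|xs| : 3 ℕ.* m < length xs
    3m<|xs| = ℕ.≤-pred (ℕ.≤-trans (ℕ.n≤1+n _) (ℕ.≤-trans (ℕ.≤-reflexive (sym 3p≡3+3m))
                (ℕ.≤-trans (ℕ.*-monoˡ-≤ p (s≤s (ℕ.m≤n+m 2 r))) bound)))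
    peel : ShortZeroSumIn χ xs → ZeroSumBlocks χ (suc r) xs
    peel (ys , τ , ys≢[] , Zys , |ys|≤p) =
      extend (zeroSumBlocks χ r (complement τ) (ℕ.+-cancelˡ-≤ p _ _ bound′))
      where
      bound′ : p ℕ.+ (r ℕ.+ 2) ℕ.* p ≤ p ℕ.+ suc (length (complement τ))
      bound′ = ℕ.≤-trans bound (ℕ.≤-trans (ℕ.≤-reflexive (cong suc (length-complement τ)))
                 (ℕ.≤-trans (s≤s (ℕ.+-monoˡ-≤ _ |ys|≤p)) (ℕ.≤-reflexive (sym (ℕ.+-suc p _)))))
      extend : ZeroSumBlocks χ r (complement τ) → ZeroSumBlocks χ (suc r) xs
      extend (yss , |yss| , Zyss , yss⊆ₘ) =
        ys ∷ yss , cong suc |yss| , (ys≢[] , Zys) ∷ Zyss , ++-complement-⊆ₘ τ yss⊆ₘ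

module _ {n : ℕ} (G : FinGroup n) where
  open FinGroup G
  open IsGroup isGroup using (assoc; identityˡ)

  asGroup : Group 0ℓ 0ℓ
  asGroup = record { isGroup = isGroup }

  open GroupProperties asGroup using (∙-cancelˡ)

  prod-++ : ∀ xs ys → prod G (xs ++ ys) ≡ prod G xs · prod G ys
  prod-++ []       ys = sym (identityˡ _)
  prod-++ (x ∷ xs) ys = trans (cong (x ·_) (prod-++ xs ys)) (sym (assoc x (prod G xs) (prod G ys)))

  prod-concat : ∀ xss → prod G (concat xss) ≡ prod G (map (prod G) xss)
  prod-concat []         = refl
  prod-concat (xs ∷ xss) = trans (prod-++ xs (concat xss)) (cong (prod G xs ·_) (prod-concat xss))

  ProductOneFree-⊆ₘ : ∀ {xs ys} → ProductOneFree G ys → xs ⊆ₘ ys → xs ≢ [] → prod G xs ≢ e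
  ProductOneFree-⊆ₘ free (zs , zs⊆ys , zs↭xs) xs≢[] Πxs≡e =
    free zs zs⊆ys (λ { refl → xs≢[] (↭-empty-inv (↭-sym zs↭xs)) }) (_ , ↭-sym zs↭xs , Πxs≡e)

  blockProducts-productOneFree : ∀ {xs} yss → All (_≢ []) yss → concat yss ⊆ₘ xs →
                                 ProductOneFree G xs → ProductOneFree G (map (prod G) yss)
  blockProducts-productOneFree yss yss≢[] yss⊆ₘxs free _ U⊆ U≢[] (U′ , U′↭U , ΠU′≡e)
    with zss , zss⊆yss , refl ← ⊆-map⁻ (prod G) yss U⊆
    with wss , refl , zss↭wss ← ↭-map-inv (prod G) (↭-sym U′↭U) =
    ProductOneFree-⊆ₘ free (⊆ₘ-trans (concat⁺-⊆ₘ (zss , zss⊆yss , zss↭wss)) yss⊆ₘxs)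
      (concat-≢[] (λ { refl → U≢[] (↭-empty-inv (↭-sym U′↭U)) })
                  (All-resp-⊆ₘ yss≢[] (zss , zss⊆yss , zss↭wss)))
      (trans (prod-concat wss) ΠU′≡e)

  prefixProducts-distinct : ∀ {xs i j} → ProductOneFree G xs → i < j → j ≤ length xs →
                            prod G (take i xs) ≢ prod G (take j xs)
  prefixProducts-distinct {xs} {i} {j} free i<j j≤|xs| Πi≡Πj =
    free ys (⊆-trans (drop-⊆ i _) (take-⊆ j xs)) ys≢[] (ys , ↭-refl , Πys≡e)
    where
    ys = drop i (take j xs)
    take-j≡take-i++ys : take j xs ≡ take i xs ++ ys
    take-j≡take-i++ys = trans (sym (List.take++drop≡id i (take j xs)))
      (cong (_++ ys) (trans (List.take-take i j xs) (cong (λ k → take k xs) (ℕ.m≤n⇒m⊓n≡m (ℕ.<⇒≤ i<j)))))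
    Πys≡e : prod G ys ≡ e
    Πys≡e = ∙-cancelˡ (prod G (take i xs)) (prod G ys) e (begin
      prod G (take i xs) · prod G ys ≡⟨ prod-++ (take i xs) ys ⟨
      prod G (take i xs ++ ys)       ≡⟨ cong (prod G) take-j≡take-i++ys ⟨
      prod G (take j xs)             ≡⟨ Πi≡Πj ⟨
      prod G (take i xs)             ≡⟨ IsGroup.identityʳ isGroup _ ⟨
      prod G (take i xs) · e         ∎)
      where open ≡-Reasoning
    ys≢[] : ys ≢ []
    ys≢[] ys≡[] = ℕ.<⇒≢ (ℕ.m<n⇒0<n∸m i<j) (begin
      0                          ≡⟨ cong length ys≡[] ⟨
      length ys                  ≡⟨ List.length-drop i (take j xs) ⟩
      length (take j xs) ℕ.∸ i   ≡⟨ cong (ℕ._∸ i) (trans (List.length-take j xs) (ℕ.m≤n⇒m⊓n≡m j≤|xs|)) ⟩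
      j ℕ.∸ i                    ∎)
      where open ≡-Reasoning

module QuotientByCp² {n : ℕ} (G : FinGroup n) {m : ℕ} (prime : Prime (suc m))
                     (H : Pred (Fin n) 0ℓ) (iso : QuotientIsoCp² prime G H) where
  open FinGroup G
  open IsGroup isGroup using (identityˡ; identityʳ)
  open GroupProperties (asGroup G) using (ε⁻¹≈ε; ∙-cancelˡ; \\-leftDividesʳ)
  open ZeroSums prime using (p; ZeroSum; ZeroSumBlocks; zeroSumBlocks)

  _⊕_ : Fin p → Fin p → Fin p
  _⊕_ = _+ₚ_ prime

  f : Fin n → Fin p × Fin p
  f = proj₁ iso

  f-reflects-cosets : ∀ x y → f x ≡ f y → inv x · y ∈ H
  f-reflects-cosets x y = proj₂ (proj₁ (proj₂ iso) x y)

  f-respects-cosets : ∀ x y → inv x · y ∈ H → f x ≡ f y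
  f-respects-cosets x y = proj₁ (proj₁ (proj₂ iso) x y)

  f-hom : ∀ x y → f (x · y) ≡ (proj₁ (f x) ⊕ proj₁ (f y) , proj₂ (f x) ⊕ proj₂ (f y))
  f-hom = proj₁ (proj₂ (proj₂ iso))

  f-surjective : ∀ c → ∃ λ x → f x ≡ c
  f-surjective = proj₂ (proj₂ (proj₂ iso))

  toℕ-⊕ : ∀ a b → toℕ (a ⊕ b) ≡ (toℕ a ℕ.+ toℕ b) % p
  toℕ-⊕ a b = Fin.toℕ-fromℕ< _

  ⊕-identityˡ : ∀ a → zero ⊕ a ≡ a
  ⊕-identityˡ a = Fin.toℕ-injective (trans (toℕ-⊕ zero a) (ℕ.m<n⇒m%n≡m (Fin.toℕ<n a)))

  f-e : f e ≡ (zero , zero)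
  f-e with x , fx≡0 ← f-surjective (zero , zero) = begin
    f e                                 ≡⟨ cong₂ _,_ (⊕-identityˡ a) (⊕-identityˡ b) ⟨
    (zero ⊕ a , zero ⊕ b)               ≡⟨ cong (λ c → (proj₁ c ⊕ a , proj₂ c ⊕ b)) fx≡0 ⟨
    (proj₁ (f x) ⊕ a , proj₂ (f x) ⊕ b) ≡⟨ f-hom x e ⟨
    f (x · e)                           ≡⟨ cong f (identityʳ x) ⟩
    f x                                 ≡⟨ fx≡0 ⟩
    (zero , zero)                       ∎
    where
    open ≡-Reasoning
    a = proj₁ (f e)
    b = proj₂ (f e)

  f-·-H : ∀ x {h} → h ∈ H → f (x · h) ≡ f x
  f-·-H x {h} h∈H = sym (f-respects-cosets x (x · h) (subst H (sym (\\-leftDividesʳ x h)) h∈H))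

  coordinates : Fin n → Vec ℕ 2
  coordinates x = toℕ (proj₁ (f x)) ∷ toℕ (proj₂ (f x)) ∷ []

  module _ (π : Fin p × Fin p → Fin p) (π-hom : ∀ x y → π (f (x · y)) ≡ π (f x) ⊕ π (f y))
           (π-e : π (f e) ≡ zero) where

    toℕ-π-prod : ∀ xs → toℕ (π (f (prod G xs))) ≡ sum (map (toℕ ∘ π ∘ f) xs) % p
    toℕ-π-prod []       = cong toℕ π-e
    toℕ-π-prod (x ∷ xs) = begin
      toℕ (π (f (x · prod G xs)))              ≡⟨ cong toℕ (π-hom x (prod G xs)) ⟩
      toℕ (π (f x) ⊕ π (f (prod G xs)))        ≡⟨ toℕ-⊕ (π (f x)) _ ⟩
      (a ℕ.+ toℕ (π (f (prod G xs)))) % p      ≡⟨ cong (λ s → (a ℕ.+ s) % p) (toℕ-π-prod xs) ⟩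
      (a ℕ.+ s % p) % p                        ≡⟨ ℕ.%-distribˡ-+ a (s % p) p ⟩
      (a % p ℕ.+ s % p % p) % p                ≡⟨ cong (λ t → (a % p ℕ.+ t) % p) (ℕ.m%n%n≡m%n s p) ⟩
      (a % p ℕ.+ s % p) % p                    ≡⟨ ℕ.%-distribˡ-+ a s p ⟨
      (a ℕ.+ s) % p                            ∎
      where
      open ≡-Reasoning
      a = toℕ (π (f x))
      s = sum (map (toℕ ∘ π ∘ f) xs)

    π-prod≡zero : ∀ xs → p ℕ∣.∣ sum (map (toℕ ∘ π ∘ f) xs) → π (f (prod G xs)) ≡ zero
    π-prod≡zero xs p∣Σ = Fin.toℕ-injective (trans (toℕ-π-prod xs) (ℕ∣.n∣m⇒m%n≡0 _ p p∣Σ))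

  vsum-coordinates : ∀ xs → vsum (map coordinates xs) ≡
    sum (map (toℕ ∘ proj₁ ∘ f) xs) ∷ sum (map (toℕ ∘ proj₂ ∘ f) xs) ∷ []
  vsum-coordinates []       = refl
  vsum-coordinates (x ∷ xs) = cong (coordinates x +ᵛ_) (vsum-coordinates xs)

  zeroSum⇒prod∈H : ∀ xs → ZeroSum coordinates xs → prod G xs ∈ H
  zeroSum⇒prod∈H xs Zxs with p∣Σ₁ ∷ p∣Σ₂ ∷ [] ← subst (Allᵛ (p ℕ∣.∣_)) (vsum-coordinates xs) Zxs =
    subst H (trans (cong (_· prod G xs) ε⁻¹≈ε) (identityˡ _)) (f-reflects-cosets e (prod G xs) fe≡fΠ)
    where
    fe≡fΠ : f e ≡ f (prod G xs)
    fe≡fΠ = trans f-e (sym (cong₂ _,_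
      (π-prod≡zero proj₁ (λ x y → cong proj₁ (f-hom x y)) (cong proj₁ f-e) xs p∣Σ₁)
      (π-prod≡zero proj₂ (λ x y → cong proj₂ (f-hom x y)) (cong proj₂ f-e) xs p∣Σ₂)))

  d[G]≤[d[H]+2]p∸2 : ∀ {dG dH} → IsSmallDavenport G dG → IsSmallDavenportOf G H dH →
                     dG ≤ (dH ℕ.+ 2) ℕ.* p ℕ.∸ 2
  d[G]≤[d[H]+2]p∸2 {dG} {dH} ((S , _ , |S|≡dG , S-free) , _) (_ , H-bound)
    with dG ℕ.≤? (dH ℕ.+ 2) ℕ.* p ℕ.∸ 2
  ... | yes dG≤ = dG≤
  ... | no  dG≰ = ⊥-elim (tooManyBlocks (zeroSumBlocks coordinates dH S bound))
    where
    bound : (dH ℕ.+ 2) ℕ.* p ≤ suc (length S)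
    bound = ℕ.≤-trans (ℕ.m≤n+m∸n _ 2) (subst (λ d → 2 ℕ.+ _ ≤ suc d) (sym |S|≡dG) (s≤s (ℕ.≰⇒> dG≰)))
    tooManyBlocks : ¬ ZeroSumBlocks coordinates dH S
    tooManyBlocks (yss , |yss|≡1+dH , Zyss , yss⊆ₘS) = ℕ.<-irrefl refl (begin-strict
      dH                       <⟨ ℕ.n<1+n dH ⟩
      suc dH                   ≡⟨ trans (sym |yss|≡1+dH) (sym (List.length-map (prod G) yss)) ⟩
      length (map (prod G) yss) ≤⟨ H-bound (map (prod G) yss) products∈H products-free ⟩
      dH                       ∎)
      where
      open ℕ.≤-Reasoning
      products∈H : All H (map (prod G) yss)
      products∈H = All.map⁺ (All.map (λ {ys} → zeroSum⇒prod∈H ys ∘ proj₂) Zyss)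
      products-free : ProductOneFree G (map (prod G) yss)
      products-free = blockProducts-productOneFree G yss (All.map proj₁ Zyss) yss⊆ₘS S-free

  module _ (NH : IsNormalSubgroup G H) {T : List (Fin n)} (T∈H : All H T)
           (T-free : ProductOneFree G T) where
    open IsNormalSubgroup NH using (e∈H; ·-closed)

    prefix : ℕ → Fin n
    prefix i = prod G (take i T)

    prefix∈H : ∀ i → prefix i ∈ H
    prefix∈H i = prod∈H (take i T) (All-resp-⊆ (take-⊆ i T) T∈H)
      where
      prod∈H : ∀ xs → All H xs → prod G xs ∈ H
      prod∈H []       []              = e∈H
      prod∈H (x ∷ xs) (x∈H ∷ xs∈H) = ·-closed x∈H (prod∈H xs xs∈H)

    prefix-injective : ∀ {i j : Fin (suc (length T))} → prefix (toℕ i) ≡ prefix (toℕ j) → i ≡ j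
    prefix-injective {i} {j} prefixes≡ with ℕ.<-cmp (toℕ i) (toℕ j)
    ... | tri< i<j _ _ = ⊥-elim (prefixProducts-distinct G T-free i<j (ℕ.≤-pred (Fin.toℕ<n j)) prefixes≡)
    ... | tri≈ _ i≡j _ = Fin.toℕ-injective i≡j
    ... | tri> _ _ j<i =
      ⊥-elim (prefixProducts-distinct G T-free j<i (ℕ.≤-pred (Fin.toℕ<n i)) (sym prefixes≡))

    representative : Fin p × Fin p → Fin n
    representative c = proj₁ (f-surjective c)

    translate : Fin (suc (length T)) × Fin (p ℕ.* p) → Fin n
    translate (i , k) = representative (remQuot p k) · prefix (toℕ i)

    f-translate : ∀ i k → f (translate (i , k)) ≡ remQuot p k
    f-translate i k = trans (f-·-H (representative (remQuot p k)) (prefix∈H (toℕ i)))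
                            (proj₂ (f-surjective (remQuot p k)))

    translate-injective : ∀ {u v} → translate u ≡ translate v → u ≡ v
    translate-injective {i , k} {j , l} ti≡tj = cong₂ _,_ (prefix-injective prefixes≡) k≡l
      where
      k≡l : k ≡ l
      k≡l = Injection.injective (↔⇒↣ (Fin.*↔× {p} {p}))
              (trans (sym (f-translate i k)) (trans (cong f ti≡tj) (f-translate j l)))
      prefixes≡ : prefix (toℕ i) ≡ prefix (toℕ j)
      prefixes≡ = ∙-cancelˡ _ _ _ (trans ti≡tj (cong (λ l → translate (j , l)) (sym k≡l)))

    [1+|T|]p²≤n : suc (length T) ℕ.* (p ℕ.* p) ≤ n
    [1+|T|]p²≤n = Fin.injective⇒≤ {f = translate ∘ Injection.to split}
                   (Injection.injective split ∘ translate-injective)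
      where
      split = ↔⇒↣ (Fin.*↔× {suc (length T)} {p ℕ.* p})

    [|T|+2]p∸2≤n/p+p∸2 : (length T ℕ.+ 2) ℕ.* p ℕ.∸ 2 ≤ n / p ℕ.+ p ℕ.∸ 2
    [|T|+2]p∸2≤n/p+p∸2 = ℕ.∸-monoˡ-≤ 2 (begin
      (length T ℕ.+ 2) ℕ.* p         ≡⟨ cong (ℕ._* p) (ℕ.+-comm (length T) 2) ⟩
      p ℕ.+ suc (length T) ℕ.* p     ≤⟨ ℕ.+-monoʳ-≤ p |T|p≤n/p ⟩
      p ℕ.+ n / p                    ≡⟨ ℕ.+-comm p (n / p) ⟩
      n / p ℕ.+ p                    ∎)
      where
      open ℕ.≤-Reasoning
      |T|p≤n/p : suc (length T) ℕ.* p ≤ n / p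
      |T|p≤n/p = subst (_≤ n / p) (ℕ.m*n/n≡m _ p)
        (ℕ./-monoˡ-≤ p (subst (_≤ n) (sym (ℕ.*-assoc (suc (length T)) p p)) [1+|T|]p²≤n))

open import Data.Nat using (_+_; _*_; _∸_)

lemma4p2 : (n : ℕ) (G : FinGroup n) (p : ℕ) (pr : Prime p)
           (H : Pred (Fin n) 0ℓ) → IsNormalSubgroup G H → QuotientIsoCp² pr G H →
           (dG dH : ℕ) → IsSmallDavenport G dG → IsSmallDavenportOf G H dH →
           (dG ≤ (dH + 2) * p ∸ 2)
           × ((dH + 2) * p ∸ 2 ≤ _/_ n p {{prime⇒nonZero pr}} + p ∸ 2)
lemma4p2 n G zero    pr H NH iso dG dH hG hH with () ← prime⇒nonZero pr
lemma4p2 n G (suc m) pr H NH iso dG _ hG hH@((T , T∈H , refl , T-free) , _) =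
  d[G]≤[d[H]+2]p∸2 hG hH , [|T|+2]p∸2≤n/p+p∸2 NH T∈H T-free
  where open QuotientByCp² G pr H iso
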